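{- Let $a\in\mathbb{C}$. The $(3,a)$-autonomous coefficients satisfy $\left[{n\atop n}\right]_{(3,a)}=a$ for all $n\ge0$ and $\left[{n\atop n-1}\right]_{(3,a)}=a\binom{n}{2}$ for all $n\ge1$.
   Context: The complete exponential Bell polynomials $B_n$ are defined by $\exp\left(\sum_{m\ge1}y_mt^m/m!\right)=\sum_{n\ge0}B_n(y_1,\dots,y_n)t^n/n!$. With $k=3$ and $\mathbf{x}=(x_1,x_2,x_3)$, define $f_0=x_1$, $f_1=x_2$, $f_2=x_3$, $f_3(\mathbf{x},a)=ae^{x_1}$ and $f_{n+3}(\mathbf{x},a)=ae^{x_1}B_n(f_1(\mathbf{x},a),\dots,f_n(\mathbf{x},a))$ for $n\ge1$. The autonomous polynomials are $A^{(3)}_n(x,a)=f_n((0,x,x),a)$, and the $(3,a)$-autonomous coefficients $\left[{n\atop i}\right]_{(3,a)}$ are defined by $A^{(3)}_{n+3}(x,a)=\sum_{i=0}^{n}\left[{n\atop i}\right]_{(3,a)}x^i$. -}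

module Defs where

open import Level using (Level)
open import Algebra.Bundles using (CommutativeRing)
open import Data.Nat using (ℕ; zero; suc; _∸_)
open import Data.Nat.Combinatorics using (_C_)
open import Data.List using (List; []; _∷_; _++_; [_])

-- Everything is parameterised by a commutative ring R (the paper uses ℂ).
module AutPoly {c ℓ : Level} (R : CommutativeRing c ℓ) where
  open CommutativeRing R using (Carrier; 0#; 1#; _+_; _*_)

  natMul : ℕ → Carrier → Carrier
  natMul zero    r = 0#
  natMul (suc n) r = r + natMul n r

  -- polynomials in one variable x, as coefficient sequences (coefficient of x^i)
  Poly : Set c
  Poly = ℕ → Carrier

  0ₚ : Poly
  0ₚ _ = 0#

  1ₚ : Poly
  1ₚ zero    = 1#
  1ₚ (suc _) = 0#

  Xₚ : Poly
  Xₚ (suc zero) = 1#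
  Xₚ _          = 0#

  _+ₚ_ : Poly → Poly → Poly
  (p +ₚ q) i = p i + q i

  _·ₚ_ : Carrier → Poly → Poly
  (r ·ₚ p) i = r * p i

  sumTo : ℕ → (ℕ → Carrier) → Carrier
  sumTo zero    f = f zero
  sumTo (suc k) f = sumTo k f + f (suc k)

  _*ₚ_ : Poly → Poly → Poly
  (p *ₚ q) k = sumTo k (λ i → p i * q (k ∸ i))

  -- Complete exponential Bell polynomials B_n(y_1,…,y_n), evaluated at
  -- polynomial arguments y k (k ≥ 1), via the standard recurrence
  --   B_0 = 1,  B_{n+1} = Σ_{k=0}^{n} C(n,k) y_{k+1} B_{n-k},
  -- which is equivalent to exp(Σ y_m t^m/m!) = Σ B_n t^n/n!.
  -- bellsRev y n = [B_n, B_{n-1}, …, B_0].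
  bellStep : (ℕ → Poly) → ℕ → ℕ → List Poly → Poly
  bellStep y n k []       = 0ₚ
  bellStep y n k (b ∷ bs) =
    (natMul (n C k) 1# ·ₚ (y (suc k) *ₚ b)) +ₚ bellStep y n (suc k) bs

  bellsRev : (ℕ → Poly) → ℕ → List Poly
  bellsRev y zero    = 1ₚ ∷ []
  bellsRev y (suc n) = bellStep y n 0 (bellsRev y n) ∷ bellsRev y n

  Bell : (ℕ → Poly) → ℕ → Poly
  Bell y n with bellsRev y n
  ... | []    = 0ₚ
  ... | b ∷ _ = b

  index : List Poly → ℕ → Poly
  index []       _       = 0ₚ
  index (p ∷ _)  zero    = p
  index (_ ∷ ps) (suc i) = index ps i

  -- Autonomous polynomials A^{(3)}_n(x,a) = f_n((0,x,x),a):
  --   A_0 = 0, A_1 = x, A_2 = x, A_3 = a·e^0 = a,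
  --   A_{n+3} = a·e^0·B_n(A_1,…,A_n).
  -- autList a n = [A_0, A_1, …, A_{n+2}].
  autList : Carrier → ℕ → List Poly
  autList a zero    = 0ₚ ∷ Xₚ ∷ Xₚ ∷ []
  autList a (suc n) =
    autList a n ++ [ a ·ₚ Bell (index (autList a n)) n ]

  A3 : Carrier → ℕ → Poly
  A3 a m = index (autList a m) m

  autCoeff : Carrier → ℕ → ℕ → Carrier
  autCoeff a n i = A3 a (n Data.Nat.+ 3) i

-- Since e^0 = 1, A_{n+3} = a·B_n(A_1,…,A_n) with A_1 = A_2 = x and deg A_{k+3} ≤ k.
-- In the recurrence B_{n+1} = x·B_n + n·x·B_{n-1} + Σ_{k≥2} C(n,k)·y_{k+1}·B_{n-k}
-- every term of the last sum has degree ≤ (k-2) + (n-k) = n-2, so by induction B_n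
-- has degree n, leading coefficient 1, and coefficient of x^{n-1} given by
-- C(n,2) + n = C(n+1,2).
module Submission where

open import Defs
open import Level using (Level; _⊔_)
open import Algebra.Bundles using (CommutativeRing)
open import Data.Nat as N using (ℕ; zero; suc; _∸_; _≤_; _<_; z≤n; s≤s; _≤?_)
open import Data.Nat.Properties as NP
  using (≤-refl; ≤-trans; ≤-reflexive; n≤1+n; n<1+n; m<n⇒m<1+n; ≰⇒>; +-suc; +-monoʳ-≤;
         m+n≤o⇒m≤o∸n; <-cmp)
open import Data.Nat.Combinatorics using (_C_; nCk+nC[k+1]≡[n+1]C[k+1])
open import Data.Product using (_×_; _,_)
open import Data.List using (List; []; _∷_; _++_; [_]; length)
open import Data.List.Properties using (length-++)
open import Data.Unit.Polymorphic using (⊤)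
open import Relation.Binary using (tri<; tri≈; tri>)
open import Relation.Binary.PropositionalEquality as ≡ using (_≡_; cong)
open import Relation.Nullary using (yes; no)

module AutonomousCoefficients {c ℓ : Level} (R : CommutativeRing c ℓ) where
  open CommutativeRing R
  open AutPoly R
  open import Relation.Binary.Reasoning.Setoid setoid

  natMul-+ : ∀ m n r → natMul (m N.+ n) r ≈ natMul m r + natMul n r
  natMul-+ zero    n r = sym (+-identityˡ _)
  natMul-+ (suc m) n r = trans (+-congˡ (natMul-+ m n r)) (sym (+-assoc _ _ _))

  sumTo-zero : ∀ k f → (∀ i → i ≤ k → f i ≈ 0#) → sumTo k f ≈ 0#
  sumTo-zero zero    f f≈0 = f≈0 0 z≤n
  sumTo-zero (suc k) f f≈0 =
    trans (+-cong (sumTo-zero k f (λ i i≤k → f≈0 i (≤-trans i≤k (n≤1+n k)))) (f≈0 (suc k) ≤-refl))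
          (+-identityʳ 0#)

  sumTo-unfoldˡ : ∀ k f → sumTo (suc k) f ≈ f 0 + sumTo k (λ i → f (suc i))
  sumTo-unfoldˡ zero    f = refl
  sumTo-unfoldˡ (suc k) f = trans (+-congʳ (sumTo-unfoldˡ k f)) (+-assoc _ _ _)

  DegreeAtMost : Poly → ℕ → Set ℓ
  DegreeAtMost p d = ∀ i → d < i → p i ≈ 0#

  0ₚ-degree : ∀ d → DegreeAtMost 0ₚ d
  0ₚ-degree d i _ = refl

  1ₚ-degree : DegreeAtMost 1ₚ 0
  1ₚ-degree (suc i) _ = refl

  degree-weaken : ∀ {p d e} → d ≤ e → DegreeAtMost p d → DegreeAtMost p e
  degree-weaken d≤e deg i e<i = deg i (≤-trans (s≤s d≤e) e<i)

  ·ₚ-degree : ∀ {p d} r → DegreeAtMost p d → DegreeAtMost (r ·ₚ p) d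
  ·ₚ-degree r deg i d<i = trans (*-congˡ (deg i d<i)) (zeroʳ r)

  +ₚ-degree : ∀ {p q d} → DegreeAtMost p d → DegreeAtMost q d → DegreeAtMost (p +ₚ q) d
  +ₚ-degree degp degq i d<i = trans (+-cong (degp i d<i) (degq i d<i)) (+-identityʳ 0#)

  *ₚ-degree : ∀ {p q d e} → DegreeAtMost p d → DegreeAtMost q e → DegreeAtMost (p *ₚ q) (d N.+ e)
  *ₚ-degree {p} {q} {d} {e} degp degq i d+e<i = sumTo-zero i _ vanishing
    where
    vanishing : ∀ j → j ≤ i → p j * q (i ∸ j) ≈ 0#
    vanishing j j≤i with j ≤? d
    ... | no  j≰d = trans (*-congʳ (degp j (≰⇒> j≰d))) (zeroˡ _)
    ... | yes j≤d = trans (*-congˡ (degq (i ∸ j) (m+n≤o⇒m≤o∸n (suc e) e+j<i))) (zeroʳ _)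
      where
      e+j<i : suc e N.+ j ≤ i
      e+j<i = ≤-trans (+-monoʳ-≤ (suc e) j≤d) (≤-trans (≤-reflexive (cong suc (NP.+-comm e d))) d+e<i)

  Xₚ*ₚ-zero : ∀ q → (Xₚ *ₚ q) 0 ≈ 0#
  Xₚ*ₚ-zero q = zeroˡ _

  Xₚ*ₚ-suc : ∀ q k → (Xₚ *ₚ q) (suc k) ≈ q k
  Xₚ*ₚ-suc q k = begin
    sumTo (suc k) (λ i → Xₚ i * q (suc k ∸ i))              ≈⟨ sumTo-unfoldˡ k _ ⟩
    0# * q (suc k) + sumTo k (λ i → Xₚ (suc i) * q (k ∸ i)) ≈⟨ +-cong (zeroˡ _) (shifted k) ⟩
    0# + q k                                                ≈⟨ +-identityˡ _ ⟩
    q k                                                     ∎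
    where
    shifted : ∀ k → sumTo k (λ i → Xₚ (suc i) * q (k ∸ i)) ≈ q k
    shifted zero    = *-identityˡ _
    shifted (suc k) = begin
      sumTo (suc k) (λ i → Xₚ (suc i) * q (suc k ∸ i))
        ≈⟨ sumTo-unfoldˡ k _ ⟩
      1# * q (suc k) + sumTo k (λ i → 0# * q (k ∸ i))
        ≈⟨ +-cong (*-identityˡ _) (sumTo-zero k _ (λ _ _ → zeroˡ _)) ⟩
      q (suc k) + 0#
        ≈⟨ +-identityʳ _ ⟩
      q (suc k)
        ∎

  Xₚ*ₚ-degree : ∀ {q d} → DegreeAtMost q d → DegreeAtMost (Xₚ *ₚ q) (suc d)
  Xₚ*ₚ-degree {q} deg (suc i) (s≤s d<i) = trans (Xₚ*ₚ-suc q i) (deg i d<i)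

  -- Descending P m bs says bs = [b_m, …, b_1, b_0] with P b_j j, the layout of bellsRev.
  data Descending (P : Poly → ℕ → Set ℓ) : ℕ → List Poly → Set (c ⊔ ℓ) where
    bottom : ∀ {b} → P b 0 → Descending P 0 (b ∷ [])
    _∷_ : ∀ {m b bs} → P b (suc m) → Descending P m bs → Descending P (suc m) (b ∷ bs)

  Descending-head : ∀ {P m b bs} → Descending P m (b ∷ bs) → P b m
  Descending-head (bottom pb)   = pb
  Descending-head (pb ∷ _) = pb

  Descending-map : ∀ {P Q : Poly → ℕ → Set ℓ} {m bs} →
                   (∀ {b j} → P b j → Q b j) → Descending P m bs → Descending Q m bs
  Descending-map f (bottom pb)     = bottom (f pb)
  Descending-map f (pb ∷ pbs) = f pb ∷ Descending-map f pbs

  Subleading : Poly → ℕ → Set ℓ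
  Subleading p zero    = ⊤
  Subleading p (suc m) = p m ≈ natMul (suc m C 2) 1#

  record BellShaped (p : Poly) (m : ℕ) : Set ℓ where
    field
      degree     : DegreeAtMost p m
      leading    : p m ≈ 1#
      subleading : Subleading p m
  open BellShaped

  1ₚ-shaped : BellShaped 1ₚ 0
  1ₚ-shaped = record { degree = 1ₚ-degree ; leading = refl ; subleading = _ }

  record Admissible (y : ℕ → Poly) : Set (c ⊔ ℓ) where
    field
      first       : y 1 ≡ Xₚ
      second      : y 2 ≡ Xₚ
      rest-degree : ∀ k → DegreeAtMost (y (3 N.+ k)) k

  module BellCoefficients {y : ℕ → Poly} (adm : Admissible y) where
    open Admissible adm

    y*ₚ-zero : ∀ {j} → y j ≡ Xₚ → ∀ p → (y j *ₚ p) 0 ≈ 0#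
    y*ₚ-zero yj≡X p rewrite yj≡X = Xₚ*ₚ-zero p

    y*ₚ-suc : ∀ {j} → y j ≡ Xₚ → ∀ p i → (y j *ₚ p) (suc i) ≈ p i
    y*ₚ-suc yj≡X p i rewrite yj≡X = Xₚ*ₚ-suc p i

    y*ₚ-degree : ∀ {j p d} → y j ≡ Xₚ → DegreeAtMost p d → DegreeAtMost (y j *ₚ p) (suc d)
    y*ₚ-degree yj≡X deg rewrite yj≡X = Xₚ*ₚ-degree deg

    bellStep-tail-degree : ∀ N k {m bs} → Descending DegreeAtMost m bs →
                           DegreeAtMost (bellStep y N (2 N.+ k) bs) (k N.+ m)
    bellStep-tail-degree N k (bottom deg) =
      +ₚ-degree (·ₚ-degree _ (*ₚ-degree (rest-degree k) deg)) (0ₚ-degree _)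
    bellStep-tail-degree N k {suc m} (deg ∷ degs) =
      +ₚ-degree (·ₚ-degree _ (*ₚ-degree (rest-degree k) deg))
                (degree-weaken (≤-reflexive (≡.sym (+-suc k m))) (bellStep-tail-degree N (suc k) degs))

    bellStep-after-head-degree : ∀ N {m b bs} → Descending DegreeAtMost m (b ∷ bs) →
                                 DegreeAtMost (bellStep y N 2 bs) m
    bellStep-after-head-degree N (bottom _)         = 0ₚ-degree 0
    bellStep-after-head-degree N {suc m} (_ ∷ degs) =
      degree-weaken (n≤1+n m) (bellStep-tail-degree N 0 degs)

    -- Above degree n only the terms x·B_{n+1} and (n+1)·x·B_n of the recurrence survive.
    bellStep-top : ∀ n {b b' bs} → DegreeAtMost (bellStep y (suc n) 2 bs) n → ∀ i → n ≤ i →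
                   bellStep y (suc n) 0 (b ∷ b' ∷ bs) (suc i) ≈ b i + natMul (suc n C 1) 1# * b' i
    bellStep-top n {b} {b'} {bs} tail-deg i n≤i = begin
      natMul 1 1# * (y 1 *ₚ b) (suc i)
        + (natMul (suc n C 1) 1# * (y 2 *ₚ b') (suc i) + bellStep y (suc n) 2 bs (suc i))
        ≈⟨ +-cong (*-cong (+-identityʳ 1#) (y*ₚ-suc first b i))
                  (+-cong (*-congˡ (y*ₚ-suc second b' i)) (tail-deg (suc i) (s≤s n≤i))) ⟩
      1# * b i + (natMul (suc n C 1) 1# * b' i + 0#)
        ≈⟨ +-cong (*-identityˡ _) (+-identityʳ _) ⟩
      b i + natMul (suc n C 1) 1# * b' i
        ∎

    bellStep-shaped : ∀ n {bs} → Descending BellShaped n bs → BellShaped (bellStep y n 0 bs) (suc n)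
    bellStep-shaped zero {b ∷ []} (bottom s) = record
      { degree     = +ₚ-degree (·ₚ-degree _ (y*ₚ-degree first (degree s))) (0ₚ-degree 1)
      ; leading    = trans (+-identityʳ _)
                       (trans (*-cong (+-identityʳ 1#) (y*ₚ-suc first b 0)) (trans (*-identityˡ _) (leading s)))
      ; subleading = trans (+-identityʳ _) (trans (*-congˡ (y*ₚ-zero first b)) (zeroʳ _))
      }
    bellStep-shaped (suc n) {_ ∷ []} (_ ∷ ())
    bellStep-shaped (suc n) {b ∷ b' ∷ bs} (s ∷ rest) = record
      { degree     = +ₚ-degree (·ₚ-degree _ (y*ₚ-degree first (degree s)))
                       (+ₚ-degree (degree-weaken (n≤1+n _) (·ₚ-degree _ (y*ₚ-degree second (degree s'))))
                                  (degree-weaken (≤-trans (n≤1+n _) (n≤1+n _)) tail-deg))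
      ; leading    = begin
          B (suc (suc n))             ≈⟨ top (suc n) (n≤1+n n) ⟩
          b (suc n) + c₁ * b' (suc n) ≈⟨ +-cong (leading s) (*-congˡ (degree s' (suc n) (n<1+n n))) ⟩
          1# + c₁ * 0#                ≈⟨ trans (+-congˡ (zeroʳ c₁)) (+-identityʳ 1#) ⟩
          1#                          ∎
      ; subleading = begin
          B (suc n)                           ≈⟨ top n ≤-refl ⟩
          b n + c₁ * b' n                     ≈⟨ +-cong (subleading s) (*-congˡ (leading s')) ⟩
          natMul (suc n C 2) 1# + c₁ * 1#     ≈⟨ trans (+-comm _ _) (+-congʳ (*-identityʳ c₁)) ⟩
          c₁ + natMul (suc n C 2) 1#          ≈⟨ sym (natMul-+ (suc n C 1) (suc n C 2) 1#) ⟩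
          natMul (suc n C 1 N.+ suc n C 2) 1# ≡⟨ cong (λ k → natMul k 1#) (nCk+nC[k+1]≡[n+1]C[k+1] (suc n) 1) ⟩
          natMul (suc (suc n) C 2) 1#         ∎
      }
      where
      B : Poly
      B = bellStep y (suc n) 0 (b ∷ b' ∷ bs)
      s' : BellShaped b' n
      s' = Descending-head rest
      c₁ : Carrier
      c₁ = natMul (suc n C 1) 1#
      tail-deg : DegreeAtMost (bellStep y (suc n) 2 bs) n
      tail-deg = bellStep-after-head-degree (suc n) (Descending-map degree rest)
      top : ∀ i → n ≤ i → B (suc i) ≈ b i + c₁ * b' i
      top = bellStep-top n {bs = bs} tail-deg

    bellsRev-shaped : ∀ n → Descending BellShaped n (bellsRev y n)
    bellsRev-shaped zero    = bottom 1ₚ-shaped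
    bellsRev-shaped (suc n) = bellStep-shaped n (bellsRev-shaped n) ∷ bellsRev-shaped n

    Bell-shaped : ∀ n → BellShaped (Bell y n) n
    Bell-shaped zero    = 1ₚ-shaped
    Bell-shaped (suc n) = bellStep-shaped n (bellsRev-shaped n)

  index-++ˡ : ∀ xs ys k → k < length xs → index (xs ++ ys) k ≡ index xs k
  index-++ˡ (x ∷ xs) ys zero    _         = ≡.refl
  index-++ˡ (x ∷ xs) ys (suc k) (s≤s k<n) = index-++ˡ xs ys k k<n

  index-++-length : ∀ xs z → index (xs ++ [ z ]) (length xs) ≡ z
  index-++-length []       z = ≡.refl
  index-++-length (x ∷ xs) z = index-++-length xs z

  index-≥length : ∀ xs k → length xs ≤ k → index xs k ≡ 0ₚ
  index-≥length []       k       _         = ≡.refl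
  index-≥length (x ∷ xs) (suc k) (s≤s n≤k) = index-≥length xs k n≤k

  module Autonomous (a : Carrier) where

    length-autList : ∀ n → length (autList a n) ≡ 3 N.+ n
    length-autList zero    = ≡.refl
    length-autList (suc n) = ≡.trans (length-++ (autList a n))
                               (≡.trans (cong (N._+ 1) (length-autList n)) (cong (3 N.+_) (NP.+-comm n 1)))

    autList-stable : ∀ n k → k < 3 N.+ n → index (autList a (suc n)) k ≡ index (autList a n) k
    autList-stable n k k<3+n =
      index-++ˡ (autList a n) _ k (≡.subst (k <_) (≡.sym (length-autList n)) k<3+n)

    autList-last : ∀ n → index (autList a (suc n)) (3 N.+ n) ≡ a ·ₚ Bell (index (autList a n)) n
    autList-last n = ≡.trans (cong (index (autList a (suc n))) (≡.sym (length-autList n)))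
                             (index-++-length (autList a n) _)

    autList-beyond : ∀ n k → 3 N.+ n ≤ k → index (autList a n) k ≡ 0ₚ
    autList-beyond n k 3+n≤k =
      index-≥length (autList a n) k (≡.subst (_≤ k) (≡.sym (length-autList n)) 3+n≤k)

    autList-admissible : ∀ n → Admissible (index (autList a n))
    autList-admissible zero    = record { first = ≡.refl ; second = ≡.refl ; rest-degree = 0ₚ-degree }
    autList-admissible (suc n) = record
      { first       = ≡.trans (autList-stable n 1 (s≤s (s≤s z≤n))) first
      ; second      = ≡.trans (autList-stable n 2 (s≤s (s≤s (s≤s z≤n)))) second
      ; rest-degree = rest-degree′
      }
      where
      adm : Admissible (index (autList a n))
      adm = autList-admissible n
      open Admissible adm

      rest-degree′ : ∀ k → DegreeAtMost (index (autList a (suc n)) (3 N.+ k)) k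
      rest-degree′ k with <-cmp k n
      ... | tri< k<n _ _ rewrite autList-stable n (3 N.+ k) (s≤s (s≤s (s≤s k<n))) = rest-degree k
      ... | tri≈ _ ≡.refl _ rewrite autList-last n =
        ·ₚ-degree a (BellShaped.degree (BellCoefficients.Bell-shaped adm n))
      ... | tri> _ _ n<k rewrite autList-beyond (suc n) (3 N.+ k) (s≤s (s≤s (s≤s n<k))) = 0ₚ-degree k

    A3-recurrence : ∀ n → A3 a (n N.+ 3) ≡ a ·ₚ Bell (index (autList a n)) n
    A3-recurrence n rewrite NP.+-comm n 3 =
      ≡.trans (autList-stable (2 N.+ n) _ (m<n⇒m<1+n (n<1+n _)))
              (≡.trans (autList-stable (1 N.+ n) _ (n<1+n _)) (autList-last n))

    autCoeff-Bell : ∀ n i → autCoeff a n i ≈ a * Bell (index (autList a n)) n i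
    autCoeff-Bell n i = reflexive (cong (λ p → p i) (A3-recurrence n))

    Bell-shaped : ∀ n → BellShaped (Bell (index (autList a n)) n) n
    Bell-shaped n = BellCoefficients.Bell-shaped (autList-admissible n) n

    autCoeff-diagonal : ∀ n → autCoeff a n n ≈ a
    autCoeff-diagonal n =
      trans (autCoeff-Bell n n) (trans (*-congˡ (leading (Bell-shaped n))) (*-identityʳ a))

    autCoeff-subdiagonal : ∀ n → autCoeff a (suc n) n ≈ a * natMul (suc n C 2) 1#
    autCoeff-subdiagonal n =
      trans (autCoeff-Bell (suc n) n) (*-congˡ (subleading (Bell-shaped (suc n))))

mainTheorem10 : ∀ {c ℓ : Level} (R : CommutativeRing c ℓ) (a : CommutativeRing.Carrier R) →
    ((n : ℕ) → CommutativeRing._≈_ R (AutPoly.autCoeff R a n n) a)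
    × ((n : ℕ) → CommutativeRing._≈_ R (AutPoly.autCoeff R a (suc n) n)
                   (CommutativeRing._*_ R a (AutPoly.natMul R (suc n C 2) (CommutativeRing.1# R))))
mainTheorem10 R a = autCoeff-diagonal , autCoeff-subdiagonal
  where open AutonomousCoefficients.Autonomous R a
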